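{- Let $S$ be a finite set partitioned as $S=S_0\cup\dots\cup S_n$, let $Q$ be a poset with elements $a_1,\dots,a_l$, and let $f_1,\dots,f_{r'}$ be distinct functions from $\{a_1,\dots,a_l\}$ to $\{S_0,\dots,S_n\}$. For each $1\le i\le r'$ let $\mathcal{S}_i$ be a nonempty family of $l$-element subsets of $S$, each of which has exactly one element in $f_i(a_j)$ for every $1\le j\le l$. Let $\underline{t}=(t_1,\dots,t_{r'})$ be a vector of positive integers and let $\Gamma$ be an $(l,\underline{t})$-covering family of $S$. Let $T$ be a hereditary property of subsets of $S$, let $\underline{w}=(w_1,\dots,w_{r'})$ have non-negative coordinates, and let $x$ be real. Assume that for every $G\in\Gamma$, every subset $G'\subseteq G$ with property $T$ satisfies $\underline{w/t}(G')\le x$. Then $\underline{w}(F)\le|\Gamma|x$ for every $F\subseteq S$ with property $T$.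
   Context: A property $T$ of subsets of $S$ is hereditary if every subset of a set with property $T$ has property $T$. A family $\Gamma$ of subsets of $S$ is $(l,\underline{t})$-covering if for each $1\le i\le r'$ and each $l$-set $L\in\mathcal{S}_i$, exactly $t_i$ members of $\Gamma$ contain $L$ (i.e. contain all elements of $L$). For $F\subseteq S$, let $f_i(F)$ be the number of $l$-sets in $\mathcal{S}_i$ all of whose elements lie in $F$; then $\underline{w}(F)=\sum_{i=1}^{r'}w_if_i(F)$, and $\underline{w/t}(F)=\sum_{i=1}^{r'}\frac{w_i}{t_i}f_i(F)$. -}

module Defs where

open import Level using (Level; _⊔_)
open import Data.Nat using (ℕ; zero; suc)
open import Data.Fin using (Fin)
import Data.Fin as F
open import Data.Bool using (Bool)
open import Data.List using (List; filter; length)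
open import Data.Fin.Subset using (Subset; _⊆_; _∩_; ∣_∣)
open import Data.Fin.Subset.Properties using (_⊆?_)
open import Data.Vec using (tabulate)
open import Relation.Nullary using (¬_; does)
open import Relation.Binary.PropositionalEquality using (_≡_)
open import Data.Fin.Properties using (_≟_)
open import Algebra.Bundles using (CommutativeRing)
open import Relation.Binary.Structures using (IsTotalOrder)

-- An ordered field (the paper uses the real numbers; ℝ is an instance).
record OrderedField (c ℓ₁ ℓ₂ : Level) : Set (Level.suc (c ⊔ ℓ₁ ⊔ ℓ₂)) where
  field
    commutativeRing : CommutativeRing c ℓ₁
  open CommutativeRing commutativeRing public
  field
    _≤_          : Carrier → Carrier → Set ℓ₂
    isTotalOrder : IsTotalOrder _≈_ _≤_
    +-monoˡ-≤    : ∀ {x y} z → x ≤ y → (x + z) ≤ (y + z)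
    *-nonneg     : ∀ {x y} → 0# ≤ x → 0# ≤ y → 0# ≤ (x * y)
    0≉1          : ¬ (0# ≈ 1#)
    _⁻¹          : Carrier → Carrier
    ⁻¹-inverse   : ∀ x → ¬ (x ≈ 0#) → (x * (x ⁻¹)) ≈ 1#

module _ {c ℓ₁ ℓ₂ : Level} (K : OrderedField c ℓ₁ ℓ₂) where
  open OrderedField K using (Carrier; 0#; 1#; _+_)

  ι : ℕ → Carrier
  ι zero    = 0#
  ι (suc k) = 1# + ι k

  Σ : (r : ℕ) → (Fin r → Carrier) → Carrier
  Σ zero    g = 0#
  Σ (suc r) g = g F.zero + Σ r (λ i → g (F.suc i))

classOf : ∀ {m n} → (Fin m → Fin (suc n)) → Fin (suc n) → Subset m
classOf part c = tabulate (λ k → does (part k ≟ c))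

countContaining : ∀ {m} → Subset m → List (Subset m) → ℕ
countContaining L 𝓕 = length (filter (λ G → L ⊆? G) 𝓕)

countInside : ∀ {m} → List (Subset m) → Subset m → ℕ
countInside 𝒮ᵢ F = length (filter (λ L → L ⊆? F) 𝒮ᵢ)

Hereditary : ∀ {m p} → (Subset m → Set p) → Set p
Hereditary {m} T = ∀ (A B : Subset m) → A ⊆ B → T B → T A

module _ {c ℓ₁ ℓ₂ : Level} (K : OrderedField c ℓ₁ ℓ₂) where
  open OrderedField K using (Carrier; _*_; _⁻¹)

  wOf : ∀ {m r} → (Fin r → List (Subset m)) → (Fin r → Carrier) → Subset m → Carrier
  wOf {r = r} 𝒮 w F = Σ K r (λ i → w i * ι K (countInside (𝒮 i) F))

  wtOf : ∀ {m r} → (Fin r → List (Subset m)) → (Fin r → Carrier) → (Fin r → ℕ) → Subset m → Carrier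
  wtOf {r = r} 𝒮 w t F = Σ K r (λ i → (w i * (ι K (t i) ⁻¹)) * ι K (countInside (𝒮 i) F))

-- Double counting: every l-set L ∈ 𝒮ᵢ with L ⊆ F lies in G ∩ F for exactly tᵢ members
-- G ∈ Γ, so Σ_{G ∈ Γ} (w/t)(G ∩ F) = w(F).  By heredity each G ∩ F has property T, so
-- each summand is at most x, whence w(F) ≤ |Γ| x.
module Submission where

open import Defs
open import Level using (Level)
open import Data.Nat using (ℕ; zero; suc; _≤_)
import Data.Nat as ℕ
open import Data.Nat.Properties using (+-*-semiring)
open import Data.Fin as Fin using (Fin)
open import Data.List using (List; []; _∷_; length; lookup; filter)
open import Data.List.Membership.Propositional using (_∈_)
open import Data.List.Membership.Propositional.Properties using (∈-lookup)
open import Data.Fin.Subset using (Subset; _⊆_; _∩_; ∣_∣)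
open import Data.Fin.Subset.Properties using (_⊆?_; p∩q⊆p; p∩q⊆q; x∈p∩q⁺)
open import Data.Product using (∃; _,_)
open import Data.Sum using (inj₁; inj₂)
open import Data.Empty using (⊥-elim)
open import Relation.Nullary using (¬_; Dec; yes; no; contradiction)
open import Relation.Unary using (Pred; Decidable)
open import Relation.Binary.PropositionalEquality as ≡ using (_≡_; _≢_)
open import Relation.Binary.Bundles using (Poset)
open import Relation.Binary.Structures using (IsTotalOrder)
open import Function.Definitions using (Injective)
import Algebra.Properties.Semiring.Sum as SemiringSum
import Algebra.Properties.Semiring.Mult as SemiringMult

module ℕΣ = SemiringSum +-*-semiring

indicator : ∀ {a} {A : Set a} → Dec A → ℕ
indicator (yes _) = 1
indicator (no _)  = 0

indicator-× : ∀ {a b c} {A : Set a} {B : Set b} {C : Set c}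
              (a? : Dec A) (b? : Dec B) (c? : Dec C) →
              (C → A) → (C → B) → (A → B → C) →
              indicator c? ≡ indicator a? ℕ.* indicator b?
indicator-× (yes _) (yes _) (yes _) _   _   _   = ≡.refl
indicator-× (yes a) (yes b) (no ¬c) _   _   abc = contradiction (abc a b) ¬c
indicator-× (no ¬a) _       (yes c) c→a _   _   = contradiction (c→a c) ¬a
indicator-× (yes _) (no ¬b) (yes c) _   c→b _   = contradiction (c→b c) ¬b
indicator-× (no _)  _       (no _)  _   _   _   = ≡.refl
indicator-× (yes _) (no _)  (no _)  _   _   _   = ≡.refl

length-filter≡∑-indicator : ∀ {a p} {A : Set a} {P : Pred A p} (P? : Decidable P) (xs : List A) →
                            length (filter P? xs) ≡ ℕΣ.∑[ k < length xs ] indicator (P? (lookup xs k))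
length-filter≡∑-indicator P? []       = ≡.refl
length-filter≡∑-indicator P? (x ∷ xs) with P? x
... | yes _ = ≡.cong suc (length-filter≡∑-indicator P? xs)
... | no _  = length-filter≡∑-indicator P? xs

⊆-∩-indicator : ∀ {m} (L G F : Subset m) →
                indicator (L ⊆? (G ∩ F)) ≡ indicator (L ⊆? G) ℕ.* indicator (L ⊆? F)
⊆-∩-indicator L G F = indicator-× (L ⊆? G) (L ⊆? F) (L ⊆? (G ∩ F))
  (λ L⊆G∩F x∈L → p∩q⊆p G F (L⊆G∩F x∈L))
  (λ L⊆G∩F x∈L → p∩q⊆q G F (L⊆G∩F x∈L))
  (λ L⊆G L⊆F x∈L → x∈p∩q⁺ (L⊆G x∈L , L⊆F x∈L))

∑-countInside-∩ : ∀ {m} (𝒮 Γ : List (Subset m)) (F : Subset m) (t : ℕ) →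
                  (∀ L → L ∈ 𝒮 → countContaining L Γ ≡ t) →
                  ℕΣ.∑[ k < length Γ ] countInside 𝒮 (lookup Γ k ∩ F) ≡ t ℕ.* countInside 𝒮 F
∑-countInside-∩ 𝒮 Γ F t covered = begin
  ∑[ k < length Γ ] countInside 𝒮 (γ k ∩ F)
    ≡⟨ sum-cong-≗ (λ k → length-filter≡∑-indicator (_⊆? (γ k ∩ F)) 𝒮) ⟩
  ∑[ k < length Γ ] ∑[ j < length 𝒮 ] indicator (σ j ⊆? (γ k ∩ F))
    ≡⟨ sum-cong-≗ (λ k → sum-cong-≗ (λ j → ⊆-∩-indicator (σ j) (γ k) F)) ⟩
  ∑[ k < length Γ ] ∑[ j < length 𝒮 ] (indicator (σ j ⊆? γ k) ℕ.* indicator (σ j ⊆? F))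
    ≡⟨ ∑-comm (λ k j → indicator (σ j ⊆? γ k) ℕ.* indicator (σ j ⊆? F)) ⟩
  ∑[ j < length 𝒮 ] ∑[ k < length Γ ] (indicator (σ j ⊆? γ k) ℕ.* indicator (σ j ⊆? F))
    ≡⟨ sum-cong-≗ (λ j → ≡.sym (*-distribʳ-sum (indicator (σ j ⊆? F))
                                               (λ k → indicator (σ j ⊆? γ k)))) ⟩
  ∑[ j < length 𝒮 ] ((∑[ k < length Γ ] indicator (σ j ⊆? γ k)) ℕ.* indicator (σ j ⊆? F))
    ≡⟨ sum-cong-≗ (λ j → ≡.cong (ℕ._* indicator (σ j ⊆? F)) (containing j)) ⟩
  ∑[ j < length 𝒮 ] (t ℕ.* indicator (σ j ⊆? F))
    ≡⟨ ≡.sym (*-distribˡ-sum t (λ j → indicator (σ j ⊆? F))) ⟩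
  t ℕ.* ∑[ j < length 𝒮 ] indicator (σ j ⊆? F)
    ≡⟨ ≡.cong (t ℕ.*_) (≡.sym (length-filter≡∑-indicator (_⊆? F) 𝒮)) ⟩
  t ℕ.* countInside 𝒮 F ∎
  where
  open ℕΣ
  open ≡.≡-Reasoning
  γ = lookup Γ
  σ = lookup 𝒮
  containing : ∀ j → ∑[ k < length Γ ] indicator (σ j ⊆? γ k) ≡ t
  containing j = ≡.trans
    (≡.sym (length-filter≡∑-indicator (σ j ⊆?_) Γ)) (covered (σ j) (∈-lookup j))

module OrderedFieldProperties {c ℓ₁ ℓ₂ : Level} (K : OrderedField c ℓ₁ ℓ₂) where
  open OrderedField K renaming (_≤_ to infix 4 _≤ᴷ_)
  open IsTotalOrder isTotalOrder using (antisym; total; ≤-respˡ-≈; ≤-respʳ-≈)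
    renaming (trans to ≤-trans; reflexive to ≤-reflexive)
  open import Algebra.Properties.Ring ring using (-1*x≈-x; -‿involutive)
  open SemiringSum semiring
  open SemiringMult semiring using (_×_; ×-homo-+; ×1-homo-*; ×-assoc-*; ×-congʳ)
  open import Relation.Binary.Reasoning.Setoid setoid

  +-mono-≤ : ∀ {a b c d} → a ≤ᴷ b → c ≤ᴷ d → a + c ≤ᴷ b + d
  +-mono-≤ {a} {b} {c} {d} a≤b c≤d = ≤-trans (+-monoˡ-≤ c a≤b)
    (≤-respˡ-≈ (+-comm c b) (≤-respʳ-≈ (+-comm d b) (+-monoˡ-≤ b c≤d)))

  sum-mono-≤ : ∀ {n} {f g : Fin n → Carrier} → (∀ i → f i ≤ᴷ g i) → sum f ≤ᴷ sum g
  sum-mono-≤ {zero}  f≤g = ≤-reflexive refl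
  sum-mono-≤ {suc n} f≤g = +-mono-≤ (f≤g Fin.zero) (sum-mono-≤ (λ i → f≤g (Fin.suc i)))

  -- If 1 ≤ 0 then 0 ≤ -1, and squaring gives 0 ≤ 1 after all.
  0≤1 : 0# ≤ᴷ 1#
  0≤1 with total 0# 1#
  ... | inj₁ 0≤1 = 0≤1
  ... | inj₂ 1≤0 = ⊥-elim (0≉1 (sym (antisym 1≤0 (≤-respʳ-≈ -1*-1≈1 (*-nonneg 0≤-1 0≤-1)))))
    where
    0≤-1 : 0# ≤ᴷ - 1#
    0≤-1 = ≤-respˡ-≈ (-‿inverseʳ 1#) (≤-respʳ-≈ (+-identityˡ (- 1#)) (+-monoˡ-≤ (- 1#) 1≤0))
    -1*-1≈1 : - 1# * - 1# ≈ 1#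
    -1*-1≈1 = trans (-1*x≈-x (- 1#)) (-‿involutive 1#)

  ι≡×1# : ∀ k → ι K k ≡ k × 1#
  ι≡×1# zero    = ≡.refl
  ι≡×1# (suc k) = ≡.cong (1# +_) (ι≡×1# k)

  ι-+ : ∀ a b → ι K (a ℕ.+ b) ≈ ι K a + ι K b
  ι-+ a b rewrite ι≡×1# (a ℕ.+ b) | ι≡×1# a | ι≡×1# b = ×-homo-+ 1# a b

  ι-* : ∀ a b → ι K (a ℕ.* b) ≈ ι K a * ι K b
  ι-* a b rewrite ι≡×1# (a ℕ.* b) | ι≡×1# a | ι≡×1# b = ×1-homo-* a b

  ι-sum : ∀ {n} (f : Fin n → ℕ) → ι K (ℕΣ.sum f) ≈ sum (λ i → ι K (f i))
  ι-sum {zero}  f = refl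
  ι-sum {suc n} f = trans (ι-+ (f Fin.zero) _) (+-congˡ (ι-sum (λ i → f (Fin.suc i))))

  ×≈ι* : ∀ n x → n × x ≈ ι K n * x
  ×≈ι* n x rewrite ι≡×1# n = sym (trans (×-assoc-* n 1# x) (×-congʳ n (*-identityˡ x)))

  0≤ι : ∀ k → 0# ≤ᴷ ι K k
  0≤ι zero    = ≤-reflexive refl
  0≤ι (suc k) = ≤-respˡ-≈ (+-identityˡ 0#) (+-mono-≤ 0≤1 (0≤ι k))

  ι≉0 : ∀ {k} → 1 ≤ k → ¬ (ι K k ≈ 0#)
  ι≉0 {suc k} _ ι≈0 = 0≉1 (antisym 0≤1 (≤-respʳ-≈ ι≈0 1≤ι))
    where
    1≤ι : 1# ≤ᴷ ι K (suc k)
    1≤ι = ≤-respˡ-≈ (+-identityʳ 1#) (+-mono-≤ (≤-reflexive refl) (0≤ι k))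

  sum-≤-ι* : ∀ {n} {f : Fin n → Carrier} {x} → (∀ i → f i ≤ᴷ x) → sum f ≤ᴷ ι K n * x
  sum-≤-ι* {n} {x = x} f≤x =
    ≤-respʳ-≈ (trans (sum-replicate n) (×≈ι* n x)) (sum-mono-≤ {g = λ _ → x} f≤x)

  Σ≡sum : ∀ r (g : Fin r → Carrier) → Σ K r g ≡ sum g
  Σ≡sum zero    g = ≡.refl
  Σ≡sum (suc r) g = ≡.cong (g Fin.zero +_) (Σ≡sum r (λ i → g (Fin.suc i)))

  *-⁻¹-cancel : ∀ w c y → ¬ (c ≈ 0#) → (w * c ⁻¹) * (c * y) ≈ w * y
  *-⁻¹-cancel w c y c≉0 = begin
    (w * c ⁻¹) * (c * y) ≈⟨ *-assoc w _ _ ⟩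
    w * (c ⁻¹ * (c * y)) ≈⟨ *-congˡ (sym (*-assoc _ _ y)) ⟩
    w * ((c ⁻¹ * c) * y) ≈⟨ *-congˡ (*-congʳ (*-comm _ _)) ⟩
    w * ((c * c ⁻¹) * y) ≈⟨ *-congˡ (*-congʳ (⁻¹-inverse c c≉0)) ⟩
    w * (1# * y)         ≈⟨ *-congˡ (*-identityˡ y) ⟩
    w * y                ∎

  weighted-double-counting :
    ∀ {r N} (w : Fin r → Carrier) (t s : Fin r → ℕ) (n : Fin r → Fin N → ℕ) →
    (∀ i → 1 ≤ t i) → (∀ i → ℕΣ.sum (n i) ≡ t i ℕ.* s i) →
    ∑[ k < N ] Σ K r (λ i → (w i * ι K (t i) ⁻¹) * ι K (n i k)) ≈ Σ K r (λ i → w i * ι K (s i))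
  weighted-double-counting {r} {N} w t s n t≥1 ∑n≡ts = begin
    ∑[ k < N ] Σ K r (λ i → w/t i * ι K (n i k))
      ≡⟨ sum-cong-≗ (λ k → Σ≡sum r (λ i → w/t i * ι K (n i k))) ⟩
    ∑[ k < N ] ∑[ i < r ] (w/t i * ι K (n i k))
      ≈⟨ ∑-comm (λ k i → w/t i * ι K (n i k)) ⟩
    ∑[ i < r ] ∑[ k < N ] (w/t i * ι K (n i k))
      ≈⟨ sum-cong-≋ (λ i → sym (*-distribˡ-sum (w/t i) (λ k → ι K (n i k)))) ⟩
    ∑[ i < r ] (w/t i * ∑[ k < N ] ι K (n i k))
      ≈⟨ sum-cong-≋ (λ i → *-congˡ (sym (ι-sum (n i)))) ⟩
    ∑[ i < r ] (w/t i * ι K (ℕΣ.sum (n i)))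
      ≡⟨ sum-cong-≗ (λ i → ≡.cong (λ z → w/t i * ι K z) (∑n≡ts i)) ⟩
    ∑[ i < r ] (w/t i * ι K (t i ℕ.* s i))
      ≈⟨ sum-cong-≋ (λ i → trans (*-congˡ (ι-* (t i) (s i))) (*-⁻¹-cancel (w i) _ _ (ι≉0 (t≥1 i)))) ⟩
    ∑[ i < r ] (w i * ι K (s i))
      ≡⟨ ≡.sym (Σ≡sum r (λ i → w i * ι K (s i))) ⟩
    Σ K r (λ i → w i * ι K (s i)) ∎
    where
    w/t : Fin r → Carrier
    w/t i = w i * ι K (t i) ⁻¹

lemma4p1 : ∀ {c ℓ₁ ℓ₂ q₁ q₂ q₃ p : Level} (K : OrderedField c ℓ₁ ℓ₂)
    (m n : ℕ) (part : Fin m → Fin (suc n))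
    (Q : Poset q₁ q₂ q₃) (l : ℕ) (a : Fin l → Poset.Carrier Q)
    → Injective _≡_ (Poset._≈_ Q) a
    → (r : ℕ) (f : Fin r → Fin l → Fin (suc n))
    → (∀ i i′ → i ≢ i′ → ∃ λ j → f i j ≢ f i′ j)
    → (𝒮 : Fin r → List (Subset m))
    → (∀ i → 𝒮 i ≢ [])
    → (∀ i L → L ∈ 𝒮 i → ∣ L ∣ ≡ l)
    → (∀ i L → L ∈ 𝒮 i → ∀ j → ∣ L ∩ classOf part (f i j) ∣ ≡ 1)
    → (t : Fin r → ℕ) → (∀ i → 1 ≤ t i)
    → (Γ : List (Subset m))
    → (∀ i L → L ∈ 𝒮 i → countContaining L Γ ≡ t i)
    → (T : Subset m → Set p) → Hereditary T
    → (w : Fin r → OrderedField.Carrier K)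
    → (∀ i → OrderedField._≤_ K (OrderedField.0# K) (w i))
    → (x : OrderedField.Carrier K)
    → (∀ G → G ∈ Γ → ∀ G′ → G′ ⊆ G → T G′ → OrderedField._≤_ K (wtOf K 𝒮 w t G′) x)
    → ∀ F → T F → OrderedField._≤_ K (wOf K 𝒮 w F) (OrderedField._*_ K (ι K (length Γ)) x)
lemma4p1 K m n part Q l a _ r f _ 𝒮 _ _ _ t t≥1 Γ covering T hereditary w _ x bounded F TF =
  ≤-respˡ-≈ Σ-wt≈w (sum-≤-ι* wt-G∩F≤x)
  where
  open OrderedField K renaming (_≤_ to infix 4 _≤ᴷ_)
  open IsTotalOrder isTotalOrder using (≤-respˡ-≈)
  open OrderedFieldProperties K
  open SemiringSum semiring using (sum-syntax)
  γ = lookup Γ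

  wt-G∩F≤x : ∀ k → wtOf K 𝒮 w t (γ k ∩ F) ≤ᴷ x
  wt-G∩F≤x k = bounded (γ k) (∈-lookup k) (γ k ∩ F) (p∩q⊆p (γ k) F)
    (hereditary (γ k ∩ F) F (p∩q⊆q (γ k) F) TF)

  Σ-wt≈w : ∑[ k < length Γ ] wtOf K 𝒮 w t (γ k ∩ F) ≈ wOf K 𝒮 w F
  Σ-wt≈w = weighted-double-counting w t (λ i → countInside (𝒮 i) F)
    (λ i k → countInside (𝒮 i) (γ k ∩ F)) t≥1
    (λ i → ∑-countInside-∩ (𝒮 i) Γ F (t i) (covering i))
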